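{- Let $N$ be a sequential logic network with $m$ primary inputs, $n$ primary outputs and $\ell$ registers with initial state $s_0\in\{0,1\}^\ell$, and let $N^b$ and $N^i$ be its 1-step base case network and 1-step inductive case network. Let $\Delta$ be a logic transformation of $N$, and let $N_\Delta$, $N^b_\Delta$, $N^i_\Delta$ be, respectively, the networks obtained by applying $\Delta$ to $N$, to all frames of $N^b$, and to the last frame of $N^i$. If $N^b$ is combinationally equivalent to $N^b_\Delta$ and $N^i$ is combinationally equivalent to $N^i_\Delta$, then $N$ and $N_\Delta$ are sequentially equivalent.
   Context: A (sequential) logic network is a directed acyclic graph whose nodes are logic gates computing Boolean functions of their fanins; its source nodes are primary inputs (PIs) or register outputs (ROs), its sinks are primary outputs (POs) or register inputs (RIs); each register is a pair (RI, RO) with an initial value, and at each clock cycle the RO takes the value the corresponding RI had in the previous cycle (the ROs hold the initial values in the first cycle). Given an input pattern $x\in\{0,1\}^m$ on the PIs and a state $y\in\{0,1\}^\ell$ on the ROs, $N(x,y)$ denotes the resulting values on the RIs and POs. The $k$-step base case network $N^b$ is the purely combinational network obtained by taking $k$ copies (frames) of $N$, connecting the RIs of each frame to the corresponding ROs of the next frame, replacing the ROs of the first frame by the registers' initial values, and designating the RIs of the last frame as POs (the POs of each frame remain POs). The $k$-step inductive case network $N^i$ is defined in the same way but with $k+1$ frames and with the ROs of the first frame taken as PIs instead of being fixed to initial values. Here $k=1$, so $N^b$ has one frame and $N^i$ has two frames. A logic transformation $\Delta$ is a local modification of a gate of the network (e.g. replacing a fanin of a gate by a constant or by another existing node not in its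 transitive fanout, with the gate's function adjusted accordingly); applying it in a frame means applying it to the copy of that gate in that frame. Two combinational networks are combinationally equivalent if they produce the same output values for every input pattern. Two sequential networks with the same initial state are sequentially equivalent if, starting from the initial state, they produce the same primary output sequences for every sequence of primary input patterns. -}

module Defs where

open import Data.Nat using (ℕ; suc; _+_)
open import Data.Bool using (Bool)
open import Data.Fin using (Fin)
open import Data.Vec using (Vec; []; _∷_; _++_; lookup; map; splitAt)
open import Data.List using (List; []; _∷_)
open import Data.Product using (_×_; _,_)
open import Relation.Binary.PropositionalEquality using (_≡_)

-- The new gate's output is pushed to the FRONT of the
-- signal vector (index zero), so a gate list 'Gates s t' turns s
-- source signals into t signals.  Topological ordering = acyclicity.

record Gate (s : ℕ) : Set where
  constructor gate
  field
    arity  : ℕ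
    fanins : Vec (Fin s) arity
    fn     : Vec Bool arity → Bool

data Gates (s : ℕ) : ℕ → Set where
  []  : Gates s s
  _∷_ : ∀ {t} → Gate s → Gates (suc s) t → Gates s t

evalGate : ∀ {s} → Gate s → Vec Bool s → Bool
evalGate (gate k ins f) v = f (map (lookup v) ins)

evalGates : ∀ {s t} → Gates s t → Vec Bool s → Vec Bool t
evalGates []       v = v
evalGates (g ∷ gs) v = evalGates gs (evalGate g v ∷ v)

-- The sources are the PIs followed by the ROs (the
-- source vector is x ++ y); each PO and each RI is driven by some
-- signal of the network; 'init' is the initial state s₀.
record SeqNet (m n ℓ : ℕ) : Set where
  field
    size  : ℕ
    gates : Gates (m + ℓ) size
    po    : Vec (Fin size) n
    ri    : Vec (Fin size) ℓ
    init  : Vec Bool ℓ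

open SeqNet public

step : ∀ {m n ℓ} → SeqNet m n ℓ → Vec Bool m → Vec Bool ℓ → Vec Bool ℓ × Vec Bool n
step N x y = let v = evalGates (gates N) (x ++ y) in map (lookup v) (ri N) , map (lookup v) (po N)

-- Logic transformations: a local modification of one gate, i.e. the
-- gate at a chosen position is replaced by a new gate (new fanins and
-- new function); fanins must be existing signals earlier in the
-- topological order, so the modified network stays acyclic.

data Transf : ∀ {s t} → Gates s t → Set where
  here  : ∀ {s t} {g : Gate s} {gs : Gates (suc s) t} → Gate s → Transf (g ∷ gs)
  there : ∀ {s t} {g : Gate s} {gs : Gates (suc s) t} → Transf gs → Transf (g ∷ gs)

applyGates : ∀ {s t} (gs : Gates s t) → Transf gs → Gates s t
applyGates (g ∷ gs) (here g′)  = g′ ∷ gs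
applyGates (g ∷ gs) (there δ) = g ∷ applyGates gs δ

LogicTransformation : ∀ {m n ℓ} → SeqNet m n ℓ → Set
LogicTransformation N = Transf (gates N)

apply : ∀ {m n ℓ} (N : SeqNet m n ℓ) → LogicTransformation N → SeqNet m n ℓ
apply N δ = record N { gates = applyGates (gates N) δ }

-- Combinational networks are compared through their input/output
-- functions: all PIs (concatenated) to all POs (concatenated).

CombEquiv : ∀ {a b} → (Vec Bool a → Vec Bool b) → (Vec Bool a → Vec Bool b) → Set
CombEquiv f g = ∀ x → f x ≡ g x

baseCase : ∀ {m n ℓ} → SeqNet m n ℓ → (Vec Bool m → Vec Bool (n + ℓ))
baseCase F x with step F x (init F)
... | r , o = o ++ r

-- 1-step inductive case network with first frame F₁ and last frame F₂.
indCase : ∀ {m n ℓ} → SeqNet m n ℓ → SeqNet m n ℓ → (Vec Bool (m + (m + ℓ)) → Vec Bool (n + (n + ℓ)))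
indCase {m} F₁ F₂ w with splitAt m w
... | x₁ , rest , _ with splitAt m rest
... | x₂ , y , _ with step F₁ x₁ y
... | r₁ , o₁ with step F₂ x₂ r₁
... | r₂ , o₂ = o₁ ++ (o₂ ++ r₂)

run : ∀ {m n ℓ} → SeqNet m n ℓ → Vec Bool ℓ → List (Vec Bool m) → List (Vec Bool n)
run N y []       = []
run N y (x ∷ xs) with step N x y
... | y′ , o = o ∷ run N y′ xs

SeqEquiv : ∀ {m n ℓ} → SeqNet m n ℓ → SeqNet m n ℓ → Set
SeqEquiv N M = ∀ xs → run N (init N) xs ≡ run M (init M) xs

{-# OPTIONS --safe #-}
module Submission where

open import Defs
open import Data.Nat using (ℕ)
open import Data.Bool using (Bool)
open import Data.Vec using (Vec; []; _∷_; _++_; splitAt)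
open import Data.Vec.Properties using (++-injective; ++-injectiveʳ)
open import Data.List using ([]; _∷_)
open import Data.Product using (_×_; _,_; proj₁; proj₂; swap)
open import Data.Product.Properties using (×-≡,≡→≡)
open import Relation.Binary.PropositionalEquality using (_≡_; refl; sym; cong; cong₂)
open Relation.Binary.PropositionalEquality.≡-Reasoning

-- Under both hypotheses the two networks have the same step function on
-- every state that is either initial or a successor state of N: the base
-- case covers s₀, and the inductive case (whose first frame is the
-- unmodified N) covers every state N (x , y) reached in one step.  These
-- states are closed under N's transitions, so the two runs from s₀
-- coincide frame by frame.

splitAt-++ : ∀ {A : Set} {m k} (xs : Vec A m) (ys : Vec A k) →
             splitAt m (xs ++ ys) ≡ (xs , ys , refl)
splitAt-++ []       ys = refl
splitAt-++ (x ∷ xs) ys rewrite splitAt-++ xs ys = refl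

++-injective-swap : ∀ {A : Set} {a b} {p q : Vec A b × Vec A a} →
                    proj₂ p ++ proj₁ p ≡ proj₂ q ++ proj₁ q → p ≡ q
++-injective-swap {p = p} {q} eq = ×-≡,≡→≡ (swap (++-injective (proj₂ p) (proj₂ q) eq))

module _ {m n ℓ : ℕ} where

  indCase-step : ∀ (F₁ F₂ : SeqNet m n ℓ) x₁ x₂ y →
                 let r₁ = proj₁ (step F₁ x₁ y) in
                 indCase F₁ F₂ (x₁ ++ (x₂ ++ y)) ≡
                   proj₂ (step F₁ x₁ y) ++ (proj₂ (step F₂ x₂ r₁) ++ proj₁ (step F₂ x₂ r₁))
  indCase-step F₁ F₂ x₁ x₂ y rewrite splitAt-++ x₁ (x₂ ++ y) | splitAt-++ x₂ y = refl

  data Reachable₁ (N : SeqNet m n ℓ) : Vec Bool ℓ → Set where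
    initial   : Reachable₁ N (init N)
    successor : ∀ x y → Reachable₁ N (proj₁ (step N x y))

  StepAgreeOn : SeqNet m n ℓ → SeqNet m n ℓ → (Vec Bool ℓ → Set) → Set
  StepAgreeOn N M P = ∀ {y} → P y → ∀ x → step N x y ≡ step M x y

  run-cong : ∀ (N M : SeqNet m n ℓ) {P : Vec Bool ℓ → Set} →
             (∀ x y → P (proj₁ (step N x y))) → StepAgreeOn N M P →
             ∀ {y} → P y → ∀ xs → run N y xs ≡ run M y xs
  run-cong N M closed agree p []       = refl
  run-cong N M closed agree {y} p (x ∷ xs) =
    cong₂ _∷_ (cong proj₂ (agree p x)) (begin
      run N (proj₁ (step N x y)) xs  ≡⟨ run-cong N M closed agree (closed x y) xs ⟩
      run M (proj₁ (step N x y)) xs  ≡⟨ cong (λ y′ → run M y′ xs) (cong proj₁ (agree p x)) ⟩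
      run M (proj₁ (step M x y)) xs  ∎)

  baseCase-agree : ∀ (N M : SeqNet m n ℓ) → init N ≡ init M →
                   CombEquiv (baseCase N) (baseCase M) →
                   ∀ x → step N x (init N) ≡ step M x (init N)
  baseCase-agree N M refl hb x = ++-injective-swap (hb x)

  indCase-agree : ∀ (N M : SeqNet m n ℓ) → CombEquiv (indCase N N) (indCase N M) →
                  ∀ x₁ y x₂ → step N x₂ (proj₁ (step N x₁ y)) ≡ step M x₂ (proj₁ (step N x₁ y))
  indCase-agree N M hi x₁ y x₂ = ++-injective-swap (++-injectiveʳ o₁ o₁ (begin
      o₁ ++ _  ≡⟨ sym (indCase-step N N x₁ x₂ y) ⟩
      indCase N N (x₁ ++ (x₂ ++ y))  ≡⟨ hi (x₁ ++ (x₂ ++ y)) ⟩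
      indCase N M (x₁ ++ (x₂ ++ y))  ≡⟨ indCase-step N M x₁ x₂ y ⟩
      o₁ ++ _  ∎))
    where o₁ = proj₂ (step N x₁ y)

theorem1 : ∀ {m n ℓ : ℕ} (N : SeqNet m n ℓ) (Δ : LogicTransformation N) →
    CombEquiv (baseCase N) (baseCase (apply N Δ)) →
    CombEquiv (indCase N N) (indCase N (apply N Δ)) →
    SeqEquiv N (apply N Δ)
theorem1 N Δ hb hi = run-cong N (apply N Δ) successor agree initial
  where
    agree : StepAgreeOn N (apply N Δ) (Reachable₁ N)
    agree initial             = baseCase-agree N (apply N Δ) refl hb
    agree (successor x₁ y) x₂ = indCase-agree N (apply N Δ) hi x₁ y x₂
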